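{- Let $G$ be a graph and let $B_1,\dots,B_k$ be the blocks of $G$. Then \[\nu(G)=\frac12\prod_{i=1}^k\bigl(2\nu(B_i)+2\bigr)-1,\] where $\nu(\cdot)$ denotes the number of NAC-colourings divided by $2$.
   Context: A block of a graph $G$ is either a maximal $2$-connected subgraph of $G$ or a bridge of $G$. A NAC-colouring of a graph $G$ is a surjective map $c\colon E(G)\to\{\mathrm{red},\mathrm{blue}\}$ such that every cycle of $G$ is either monochromatic or contains at least two red and at least two blue edges. -}

module Defs where

open import Data.Bool using (Bool; true; false; T)
open import Data.Nat using (ℕ; suc; _≤_; _+_)
open import Data.Nat.DivMod using (_mod_)
open import Data.Fin using (Fin; toℕ) renaming (_<_ to _<ᶠ_)
open import Data.Fin.Properties using (<-cmp)
open import Data.List using (List; length; filter; allFin)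
open import Data.List.Relation.Unary.All using (All)
open import Data.List.Relation.Unary.Any using (Any)
open import Data.List.Relation.Unary.AllPairs using (AllPairs)
open import Data.Product using (Σ; Σ-syntax; ∃; _×_; _,_)
open import Data.Sum using (_⊎_)
open import Data.Empty using (⊥-elim)
open import Relation.Nullary using (¬_; yes; no)
open import Relation.Nullary.Decidable using (T?)
open import Relation.Binary using (tri<; tri≈; tri>; DecidableEquality)
open import Relation.Binary.PropositionalEquality using (_≡_; _≢_; refl; subst)
open import Relation.Binary.Construct.Closure.ReflexiveTransitive using (Star)

-- The ambient vertex universe is Fin n; a graph
-- has a vertex set V ⊆ Fin n and a symmetric irreflexive adjacency whose
-- edges have both endpoints in V.  Subgraphs of G live in the same
-- universe.

record Graph (n : ℕ) : Set where
  field
    V       : Fin n → Bool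
    adj     : Fin n → Fin n → Bool
    adj-sym : ∀ u v → adj u v ≡ adj v u
    adj-irr : ∀ v → adj v v ≡ false
    adj-V   : ∀ u v → T (adj u v) → T (V u)

open Graph public

module _ {n : ℕ} where

  InV : Graph n → Fin n → Set
  InV G v = T (V G v)

  Adj : Graph n → Fin n → Fin n → Set
  Adj G u v = T (adj G u v)

  ∣V∣ : Graph n → ℕ
  ∣V∣ G = length (filter (λ v → T? (V G v)) (allFin n))

  Edge : Graph n → Set
  Edge G = Σ[ u ∈ Fin n ] Σ[ v ∈ Fin n ] (u <ᶠ v × Adj G u v)

  toEdge : (G : Graph n) {u v : Fin n} → Adj G u v → Edge G
  toEdge G {u} {v} a with <-cmp u v
  ... | tri< lt _ _ = u , v , lt , a
  ... | tri≈ _ refl _ = ⊥-elim (subst T (adj-irr G u) a)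
  ... | tri> _ _ gt = v , u , gt , subst T (adj-sym G u v) a

  _⊆G_ : Graph n → Graph n → Set
  H ⊆G G = (∀ v → InV H v → InV G v) × (∀ u v → Adj H u v → Adj G u v)

  SameGraph : Graph n → Graph n → Set
  SameGraph H K = H ⊆G K × K ⊆G H

  Connected : Graph n → Set
  Connected H = ∀ u v → InV H u → InV H v → Star (Adj H) u v

  TwoConnected : Graph n → Set
  TwoConnected H =
    3 ≤ ∣V∣ H × Connected H ×
    (∀ x → InV H x → ∀ u v → InV H u → InV H v → u ≢ x → v ≢ x →
       Star (λ a b → Adj H a b × a ≢ x × b ≢ x) u v)

  MaximalTwoConnected : Graph n → Graph n → Set
  MaximalTwoConnected G H =
    H ⊆G G × TwoConnected H ×
    (∀ K → H ⊆G K → K ⊆G G → TwoConnected K → K ⊆G H)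

  IsBridge : Graph n → Fin n → Fin n → Set
  IsBridge G u v =
    Adj G u v ×
    ¬ Star (λ a b → Adj G a b × ¬ ((a ≡ u × b ≡ v) ⊎ (a ≡ v × b ≡ u))) u v

  BridgeBlock : Graph n → Graph n → Set
  BridgeBlock G H = Σ[ u ∈ Fin n ] Σ[ v ∈ Fin n ]
    (IsBridge G u v ×
     (∀ w → (InV H w → w ≡ u ⊎ w ≡ v) × (w ≡ u ⊎ w ≡ v → InV H w)) ×
     (∀ a b → (Adj H a b → (a ≡ u × b ≡ v) ⊎ (a ≡ v × b ≡ u)) ×
              ((a ≡ u × b ≡ v) ⊎ (a ≡ v × b ≡ u) → Adj H a b)))

  IsBlock : Graph n → Graph n → Set
  IsBlock G H = MaximalTwoConnected G H ⊎ BridgeBlock G H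

data Colour : Set where
  red blue : Colour

_≟ᶜ_ : DecidableEquality Colour
red  ≟ᶜ red  = yes refl
red  ≟ᶜ blue = no (λ ())
blue ≟ᶜ red  = no (λ ())
blue ≟ᶜ blue = yes refl

next : ∀ {k} → Fin (suc k) → Fin (suc k)
next {k} i = suc (toℕ i) mod (suc k)

module _ {n : ℕ} where

  record Cycle (G : Graph n) : Set where
    field
      len    : ℕ
      vs     : Fin (3 + len) → Fin n
      vs-inj : ∀ i j → vs i ≡ vs j → i ≡ j
      closed : ∀ i → Adj G (vs i) (vs (next i))

  open Cycle public

  cedge : {G : Graph n} (C : Cycle G) → Fin (3 + len C) → Edge G
  cedge {G} C i = toEdge G (closed C i)

  Colouring : Graph n → Set
  Colouring G = Edge G → Colour

  countColour : {G : Graph n} → Cycle G → Colouring G → Colour → ℕ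
  countColour C c col = length (filter (λ i → c (cedge C i) ≟ᶜ col) (allFin (3 + len C)))

  IsNAC : (G : Graph n) → Colouring G → Set
  IsNAC G c =
    (Σ[ e ∈ Edge G ] c e ≡ red) × (Σ[ e ∈ Edge G ] c e ≡ blue) ×
    (∀ (C : Cycle G) →
       (∀ i j → c (cedge C i) ≡ c (cedge C j))
       ⊎ (2 ≤ countColour C c red × 2 ≤ countColour C c blue))

  -- colourings are functions; they are identified when pointwise equal
  _≗ᶜ_ : {G : Graph n} → Colouring G → Colouring G → Set
  c ≗ᶜ d = ∀ e → c e ≡ d e

  NACCount : Graph n → ℕ → Set
  NACCount G m = Σ[ L ∈ List (Colouring G) ]
    (length L ≡ m × All (IsNAC G) L × AllPairs (λ c d → ¬ (_≗ᶜ_ {G} c d)) L ×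
     (∀ c → IsNAC G c → Any (λ d → _≗ᶜ_ {G} c d) L))

{-# OPTIONS --safe #-}
module Submission where

-- A colouring satisfies the cycle condition of NAC-colourings (every cycle monochromatic or with
-- at least two edges of each colour) iff it is a NAC-colouring or one of the two monochromatic
-- colourings, so when G has an edge there are m + 2 of them. Every edge of G lies in exactly one
-- block and every cycle inside a single block, so a colouring of G satisfies the cycle condition
-- iff its restriction to each block does: restriction is a bijection onto tuples of such
-- colourings of the blocks, and m + 2 = ∏ (N i + 2). The graph theory (maximal 2-connected
-- subgraphs, bridges) is classical and is carried out in the double-negation monad, which
-- suffices because the conclusion is an equation between natural numbers.

open import Defs
open import Level using (0ℓ)
open import Data.Bool using (Bool; true; false; T; _∧_; _∨_)
open import Data.Bool.Properties using (T-∧; T-∨; ∧-comm; T-irrelevant)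
open import Data.Empty using (⊥-elim)
open import Data.Fin using (Fin; zero; suc; inject₁; fromℕ) renaming (_<_ to _<ᶠ_)
open import Data.Fin.Properties
  using (_≟_; ∀-cons; <-cmp; <-irrelevant; toℕ-injective; toℕ-fromℕ<; toℕ-inject₁; toℕ-fromℕ; toℕ<n)
import Data.Fin.Properties as Fin
open import Data.List
  using (List; []; _∷_; _++_; _∷ʳ_; length; map; filter; filterᵇ; tabulate; allFin;
         cartesianProductWith; cartesianProduct)
open import Data.List.Properties
  using (length-removeAt′; length-map; length-++; length-filter; length-tabulate; filter-≐;
         ++-assoc; ++-identityʳ; tabulate-cong; map-tabulate)
open import Data.List.Membership.Propositional using (_∈_; _∉_)
open import Data.List.Membership.Propositional.Properties
  using (∈-∃++; ∈-++⁺ˡ; ∈-++⁺ʳ; ∈-++⁻; ∈-filter⁺; ∈-filter⁻; ∈-allFin; ∈-tabulate⁺; ∈-cartesianProductWith⁺)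
import Data.List.Membership.DecPropositional as DecMembership
import Data.List.Membership.Setoid as SetoidMembership
import Data.List.Membership.Setoid.Properties as SetoidMembershipProperties
open import Data.List.Relation.Unary.All as All using (All; []; _∷_)
import Data.List.Relation.Unary.All.Properties as All
open import Data.List.Relation.Unary.All.Properties using (All¬⇒¬Any; ¬Any⇒All¬)
open import Data.List.Relation.Unary.Any using (Any; here; there; index; _─_)
open import Data.List.Relation.Unary.AllPairs using ([]; _∷_)
import Data.List.Relation.Unary.AllPairs.Properties as AllPairs
open import Data.List.Relation.Unary.Linked as Linked using (Linked; []; [-]; _∷_)
open import Data.List.Relation.Unary.Unique.Propositional using (Unique)
import Data.List.Relation.Unary.Unique.Propositional.Properties as Unique
import Data.List.Relation.Unary.Unique.Setoid as SetoidUnique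
import Data.List.Relation.Unary.Unique.Setoid.Properties as SetoidUniqueProperties
open import Data.Nat using (ℕ; zero; suc; _+_; _*_; _≤_; _<_; z≤n; s≤s)
open import Data.Nat.DivMod using (_%_; m<n⇒m%n≡m; n%n≡0)
open import Data.Nat.ListAction using (product)
open import Data.Nat.Properties
  using (≤-trans; <-≤-trans; ≤-antisym; <⇒≱; m≤m+n; m≤n⇒m≤1+n; m<n⇒m<1+n;
         +-mono-≤; +-mono-<-≤; +-mono-≤-<; +-monoʳ-≤; +-suc)
import Data.Nat.Properties as ℕ
open import Data.Product using (Σ; ∃; _×_; _,_; proj₁; proj₂; map₁; uncurry)
open import Data.Sum as Sum using (_⊎_; inj₁; inj₂; [_,_])
open import Effect.Monad using (RawMonad)
open import Function using (_∘_; id; case_of_; Equivalence; Inverse; Injection)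
open import Function.Consequences.Setoid using (strictlyInverseˡ⇒inverseˡ; strictlyInverseʳ⇒inverseʳ)
open import Function.Properties.Inverse using (Inverse⇒Injection)
import Function.Construct.Symmetry as Symmetry
open import Relation.Binary using (Setoid; DecidableEquality; tri<; tri≈; tri>)
open import Relation.Binary.Construct.Closure.ReflexiveTransitive as Star using (Star; ε; _◅_; _◅◅_)
open import Relation.Binary.PropositionalEquality as ≡ using (_≡_; _≢_; _→-setoid_; module ≡-Reasoning)
open import Relation.Nullary using (¬_; yes; no)
open import Relation.Nullary.Decidable using (T?; ⌊_⌋; toWitness; fromWitness; decidable-stable; ¬¬-excluded-middle)
open import Relation.Nullary.Negation using (¬¬-Monad)
open import Relation.Unary using (Pred)

open RawMonad (¬¬-Monad {0ℓ}) using (pure; _>>=_; _<$>_; _<*>_; rawApplicative)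

-- Counting up to a setoid equality

module _ {c ℓ} (S : Setoid c ℓ) where

  open Setoid S
  open SetoidMembership S using () renaming (_∈_ to _∈ₛ_)
  open SetoidUnique S using () renaming (Unique to Uniqueₛ)

  ∈-─⁺ : ∀ {x y ys} (x∈ys : x ∈ₛ ys) → y ∈ₛ ys → ¬ x ≈ y → y ∈ₛ (ys ─ x∈ys)
  ∈-─⁺ (here x≈z) (here y≈z) x≉y = ⊥-elim (x≉y (trans x≈z (sym y≈z)))
  ∈-─⁺ (here _)   (there y∈) _   = y∈
  ∈-─⁺ (there _)  (here y≈z) _   = here y≈z
  ∈-─⁺ (there x∈) (there y∈) x≉y = there (∈-─⁺ x∈ y∈ x≉y)

  Unique⇒length≤ : ∀ {xs ys} → Uniqueₛ xs → All (_∈ₛ ys) xs → length xs ≤ length ys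
  Unique⇒length≤ [] [] = z≤n
  Unique⇒length≤ {ys = ys} (x≉xs ∷ xs!) (x∈ys ∷ xs⊆ys) =
    ≡.subst (_ ≤_) (≡.sym (length-removeAt′ ys (index x∈ys)))
      (s≤s (Unique⇒length≤ xs! (All.zipWith (λ (x≉y , y∈ys) → ∈-─⁺ x∈ys y∈ys x≉y) (x≉xs , xs⊆ys))))

module _ (S : Setoid 0ℓ 0ℓ) where

  open Setoid S using (Carrier)

  record Enumeration (P : Pred Carrier 0ℓ) (xs : List Carrier) : Set where
    field
      unique   : SetoidUnique.Unique S xs
      sound    : All P xs
      complete : ∀ {x} → P x → ¬ ¬ SetoidMembership._∈_ S x xs

open Enumeration

enumeration-length-≤ : ∀ {S₁ S₂ : Setoid 0ℓ 0ℓ} {P Q xs ys} (f : Injection S₁ S₂) →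
  (∀ {x} → P x → Q (Injection.to f x)) →
  Enumeration S₁ P xs → Enumeration S₂ Q ys → ¬ ¬ length xs ≤ length ys
enumeration-length-≤ {S₁} {S₂} {xs = xs} {ys} f P⇒Q enumP enumQ = do
  fxs⊆ys ← All.sequenceM 0ℓ ¬¬-Monad (All.map (complete enumQ ∘ P⇒Q) (sound enumP))
  pure (≡.subst (_≤ length ys) (length-map to xs)
    (Unique⇒length≤ S₂ (SetoidUniqueProperties.map⁺ S₁ S₂ injective (unique enumP)) (All.map⁺ fxs⊆ys)))
  where open Injection f

enumeration-length-≡ : ∀ {S₁ S₂ : Setoid 0ℓ 0ℓ} {P Q xs ys} (f : Inverse S₁ S₂) →
  (∀ {x} → P x → Q (Inverse.to f x)) → (∀ {y} → Q y → P (Inverse.from f y)) →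
  Enumeration S₁ P xs → Enumeration S₂ Q ys → length xs ≡ length ys
enumeration-length-≡ {xs = xs} {ys} f P⇒Q Q⇒P enumP enumQ = decidable-stable (length xs ℕ.≟ length ys)
  (≤-antisym <$> enumeration-length-≤ (Inverse⇒Injection f) P⇒Q enumP enumQ
             <*> enumeration-length-≤ (Inverse⇒Injection (Symmetry.inverse f)) Q⇒P enumQ enumP)

Π-setoid : ∀ {k} → (Fin k → Setoid 0ℓ 0ℓ) → Setoid 0ℓ 0ℓ
Π-setoid S = record
  { Carrier       = ∀ i → Setoid.Carrier (S i)
  ; _≈_           = λ s t → ∀ i → Setoid._≈_ (S i) (s i) (t i)
  ; isEquivalence = record
    { refl  = λ i → Setoid.refl (S i)
    ; sym   = λ s≈t i → Setoid.sym (S i) (s≈t i)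
    ; trans = λ s≈t t≈u i → Setoid.trans (S i) (s≈t i) (t≈u i)
    }
  }

length-cartesianProductWith : ∀ {A B C : Set} (f : A → B → C) xs ys →
  length (cartesianProductWith f xs ys) ≡ length xs * length ys
length-cartesianProductWith f []       ys = ≡.refl
length-cartesianProductWith f (x ∷ xs) ys = ≡.trans (length-++ (map (f x) ys))
  (≡.cong₂ _+_ (length-map (f x) ys) (length-cartesianProductWith f xs ys))

tuples : ∀ {k} {A : Fin k → Set} → (∀ i → List (A i)) → List (∀ i → A i)
tuples {zero}      ls = (λ ()) ∷ []
tuples {suc k} {A} ls = cartesianProductWith (∀-cons {P = A}) (ls zero) (tuples (ls ∘ suc))

length-tuples : ∀ {k} {A : Fin k → Set} (ls : ∀ i → List (A i)) →
  length (tuples ls) ≡ product (tabulate (length ∘ ls))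
length-tuples {zero}      ls = ≡.refl
length-tuples {suc k} {A} ls = ≡.trans (length-cartesianProductWith (∀-cons {P = A}) (ls zero) (tuples (ls ∘ suc)))
  (≡.cong (length (ls zero) *_) (length-tuples (ls ∘ suc)))

∈-tuples⁺ : ∀ {k} (S : Fin k → Setoid 0ℓ 0ℓ) {ls : ∀ i → List (Setoid.Carrier (S i))} {t} →
  (∀ i → SetoidMembership._∈_ (S i) (t i) (ls i)) → SetoidMembership._∈_ (Π-setoid S) t (tuples ls)
∈-tuples⁺ {zero}  S t∈ls = here (λ ())
∈-tuples⁺ {suc k} S t∈ls = SetoidMembershipProperties.∈-resp-≈ (Π-setoid S) cons≈t
  (SetoidMembershipProperties.∈-cartesianProductWith⁺ (S zero) (Π-setoid (S ∘ suc)) (Π-setoid S)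
    cons-cong (t∈ls zero) (∈-tuples⁺ (S ∘ suc) (t∈ls ∘ suc)))
  where
  cons-cong : ∀ {a b s t} → Setoid._≈_ (S zero) a b → Setoid._≈_ (Π-setoid (S ∘ suc)) s t →
    Setoid._≈_ (Π-setoid S) (∀-cons a s) (∀-cons b t)
  cons-cong a≈b s≈t zero    = a≈b
  cons-cong a≈b s≈t (suc i) = s≈t i
  cons≈t : Setoid._≈_ (Π-setoid S) (∀-cons _ _) _
  cons≈t zero    = Setoid.refl (S zero)
  cons≈t (suc i) = Setoid.refl (S (suc i))

tuples-unique : ∀ {k} (S : Fin k → Setoid 0ℓ 0ℓ) {ls} → (∀ i → SetoidUnique.Unique (S i) (ls i)) →
  SetoidUnique.Unique (Π-setoid S) (tuples ls)
tuples-unique {zero}  S _  = [] ∷ []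
tuples-unique {suc k} S ls! =
  SetoidUniqueProperties.cartesianProductWith⁺ (S zero) (Π-setoid (S ∘ suc)) (Π-setoid S)
    ∀-cons (λ cons≈cons → cons≈cons zero , cons≈cons ∘ suc) (ls! zero) (tuples-unique (S ∘ suc) (ls! ∘ suc))

All-tuples⁺ : ∀ {k} {A : Fin k → Set} {P : ∀ i → Pred (A i) 0ℓ} {ls : ∀ i → List (A i)} →
  (∀ i → All (P i) (ls i)) → All (λ t → ∀ i → P i (t i)) (tuples ls)
All-tuples⁺ {zero}              _   = (λ ()) ∷ []
All-tuples⁺ {suc k} {A} {P} {ls} Pls =
  All.cartesianProductWith⁺ (≡.setoid (A zero)) (≡.setoid (∀ i → A (suc i))) ∀-cons (ls zero) (tuples (ls ∘ suc))
    λ x∈ t∈ → λ { zero    → All.lookup (Pls zero) x∈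
                ; (suc i) → All.lookup (All-tuples⁺ (Pls ∘ suc)) t∈ i }

tuples-enumeration : ∀ {k} (S : Fin k → Setoid 0ℓ 0ℓ) {P : ∀ i → Pred (Setoid.Carrier (S i)) 0ℓ} {ls} →
  (∀ i → Enumeration (S i) (P i) (ls i)) → Enumeration (Π-setoid S) (λ t → ∀ i → P i (t i)) (tuples ls)
tuples-enumeration S enums = record
  { unique   = tuples-unique S (unique ∘ enums)
  ; sound    = All-tuples⁺ (sound ∘ enums)
  ; complete = λ Pt → ∈-tuples⁺ S <$> Fin.sequence rawApplicative (λ i → complete (enums i) (Pt i))
  }

-- Lists and walks

∉-middle : {A : Set} (as : List A) {x : A} {bs : List A} → Unique (as ++ x ∷ bs) → x ∉ as × x ∉ bs
∉-middle []       (x≢bs ∷ _) = (λ ()) , All¬⇒¬Any x≢bs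
∉-middle (a ∷ as) {x} (a≢ ∷ u) =
    (λ { (here ≡.refl) → All.lookup a≢ (∈-++⁺ʳ as (here ≡.refl)) ≡.refl
       ; (there x∈as)  → proj₁ (∉-middle as u) x∈as })
  , proj₂ (∉-middle as u)

module _ {A : Set} {R : A → A → Set} where

  Linked-++⁻ˡ : ∀ xs {ys} → Linked R (xs ++ ys) → Linked R xs
  Linked-++⁻ˡ []           _       = []
  Linked-++⁻ˡ (x ∷ [])     _       = [-]
  Linked-++⁻ˡ (x ∷ y ∷ xs) (r ∷ l) = r ∷ Linked-++⁻ˡ (y ∷ xs) l

  Linked-++⁻ʳ : ∀ xs {ys} → Linked R (xs ++ ys) → Linked R ys
  Linked-++⁻ʳ []       l = l
  Linked-++⁻ʳ (x ∷ xs) l = Linked-++⁻ʳ xs (Linked.tail l)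

  Linked-join : ∀ xs {y ys} → Linked R (xs ∷ʳ y) → Linked R (y ∷ ys) → Linked R (xs ++ y ∷ ys)
  Linked-join []           _       l = l
  Linked-join (x ∷ [])     (r ∷ _) l = r ∷ l
  Linked-join (x ∷ x′ ∷ xs) (r ∷ l′) l = r ∷ Linked-join (x′ ∷ xs) l′ l

  Linked-∩ : {P : A → Set} {xs : List A} → Linked R xs → All P xs → Linked (λ a b → R a b × P a × P b) xs
  Linked-∩ []      _                  = []
  Linked-∩ [-]     _                  = [-]
  Linked-∩ (r ∷ l) (Pa ∷ Pbs@(Pb ∷ _)) = (r , Pa , Pb) ∷ Linked-∩ l Pbs

  Linked-reach : ∀ {x y xs} → Linked R (x ∷ xs) → y ∈ x ∷ xs → Star R x y
  Linked-reach _       (here ≡.refl) = ε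
  Linked-reach (r ∷ l) (there y∈)    = r ◅ Linked-reach l y∈

  Linked⇒Star : (∀ {a b} → R a b → R b a) → ∀ {xs x y} → Linked R xs → x ∈ xs → y ∈ xs → Star R x y
  Linked⇒Star sym {_ ∷ _} l x∈ y∈ = Star.reverse sym (Linked-reach l x∈) ◅◅ Linked-reach l y∈

  Linked-rotate : ∀ {x₀ xs} as {x} bs → x₀ ∷ xs ≡ as ++ x ∷ bs → Linked R (x₀ ∷ xs ∷ʳ x₀) → Linked R (bs ++ as)
  Linked-rotate [] bs ≡.refl l = ≡.subst (Linked R) (≡.sym (++-identityʳ bs)) (Linked-++⁻ˡ bs (Linked.tail l))
  Linked-rotate (a ∷ as) {x} bs ≡.refl l =
    Linked-join bs (Linked.tail (Linked-++⁻ʳ (a ∷ as) l′)) (Linked-++⁻ˡ (a ∷ as) l′)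
    where
    l′ : Linked R ((a ∷ as) ++ x ∷ bs ∷ʳ a)
    l′ = ≡.subst (Linked R) (≡.cong (a ∷_) (++-assoc as (x ∷ bs) _)) l

  walkVertices : ∀ {a b} → Star R a b → List A
  walkVertices {a} ε       = a ∷ []
  walkVertices {a} (_ ◅ s) = a ∷ walkVertices s

  first-step : ∀ {a b} → a ≢ b → Star R a b → ∃ (R a)
  first-step a≢b ε       = ⊥-elim (a≢b ≡.refl)
  first-step _   (r ◅ _) = _ , r

  target∈walkVertices : ∀ {a b} (s : Star R a b) → b ∈ walkVertices s
  target∈walkVertices ε       = here ≡.refl
  target∈walkVertices (_ ◅ s) = there (target∈walkVertices s)

  1≤length-walkVertices : ∀ {a b} (s : Star R a b) → 1 ≤ length (walkVertices s)
  1≤length-walkVertices ε       = s≤s z≤n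
  1≤length-walkVertices (_ ◅ _) = s≤s z≤n

  walk-linked : {S : A → A → Set} → (∀ {a b} → R a b → S a b) → ∀ {a b c} (s : Star R a b) → S b c →
    Linked S (walkVertices s ∷ʳ c)
  walk-linked f ε               r′ = r′ ∷ [-]
  walk-linked f (r ◅ ε)         r′ = f r ∷ r′ ∷ [-]
  walk-linked f (r ◅ s@(_ ◅ _)) r′ = f r ∷ walk-linked f s r′

  module _ (_≟ᴬ_ : DecidableEquality A) where

    open DecMembership _≟ᴬ_ using (_∈?_)

    private
      suffix : ∀ {a b c} (s : Star R c b) → a ∈ walkVertices s → Unique (walkVertices s) →
        Σ (Star R a b) (Unique ∘ walkVertices)
      suffix ε         (here ≡.refl) s!       = ε , s!
      suffix s@(_ ◅ _) (here ≡.refl) s!       = s , s!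
      suffix (_ ◅ s)   (there a∈s)   (_ ∷ s!) = suffix s a∈s s!

    path : ∀ {a b} → Star R a b → Σ (Star R a b) (Unique ∘ walkVertices)
    path ε = ε , [] ∷ []
    path {a} (r ◅ s) with path s
    ... | p , p! with a ∈? walkVertices p
    ...   | yes a∈p = suffix p a∈p p!
    ...   | no  a∉p = r ◅ p , ¬Any⇒All¬ _ a∉p ∷ p!

module _ {A : Set} where

  countᵇ : (A → Bool) → List A → ℕ
  countᵇ p xs = length (filterᵇ p xs)

  module _ {p q : A → Bool} (p⇒q : ∀ {x} → T (p x) → T (q x)) where

    countᵇ-mono : ∀ xs → countᵇ p xs ≤ countᵇ q xs
    countᵇ-mono []       = z≤n
    countᵇ-mono (x ∷ xs) with p x | q x | p⇒q {x}
    ... | true  | true  | _  = s≤s (countᵇ-mono xs)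
    ... | true  | false | pq = ⊥-elim (pq _)
    ... | false | true  | _  = m≤n⇒m≤1+n (countᵇ-mono xs)
    ... | false | false | _  = countᵇ-mono xs

    countᵇ-mono-< : ∀ {y xs} → y ∈ xs → T (q y) → ¬ T (p y) → countᵇ p xs < countᵇ q xs
    countᵇ-mono-< {y} {_ ∷ xs} (here ≡.refl) qy ¬py with p y | q y
    ... | true  | _    = ⊥-elim (¬py _)
    ... | false | true = s≤s (countᵇ-mono xs)
    countᵇ-mono-< {xs = x ∷ xs} (there y∈xs) qy ¬py with p x | q x | p⇒q {x}
    ... | true  | true  | _  = s≤s (countᵇ-mono-< y∈xs qy ¬py)
    ... | true  | false | pq = ⊥-elim (pq _)
    ... | false | true  | _  = m<n⇒m<1+n (countᵇ-mono-< y∈xs qy ¬py)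
    ... | false | false | _  = countᵇ-mono-< y∈xs qy ¬py

-- Maximal elements

module _ {X : Set} (_≼_ : X → X → Set)
         (≼-refl : ∀ {x} → x ≼ x) (≼-trans : ∀ {x y z} → x ≼ y → y ≼ z → x ≼ z)
         (≼-stable : ∀ {x y} → ¬ ¬ x ≼ y → x ≼ y)
         (μ : X → ℕ) (bound : ℕ) (μ≤bound : ∀ x → μ x ≤ bound)
         (μ-strict : ∀ {x y} → x ≼ y → ¬ y ≼ x → ¬ ¬ μ x < μ y)
         (P : X → Set) where

  MaximalAbove : X → Set
  MaximalAbove x = ∃ λ y → x ≼ y × P y × (∀ z → y ≼ z → P z → z ≼ y)

  ¬¬-maximal-above : ∀ {x} → P x → ¬ ¬ MaximalAbove x
  ¬¬-maximal-above {x} = climb bound (m≤m+n bound (μ x))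
    where
    climb : ∀ d {x} → bound ≤ d + μ x → P x → ¬ ¬ MaximalAbove x
    climb d {x} bound≤ Px = ¬¬-excluded-middle >>= λ
      { (no ¬above) → pure (x , ≼-refl , Px , λ z x≼z Pz → ≼-stable λ z⋠x → ¬above (z , x≼z , Pz , z⋠x))
      ; (yes (z , x≼z , Pz , z⋠x)) → μ-strict x≼z z⋠x >>= λ μx<μz → step d bound≤ μx<μz Pz >>= λ
          (y , z≼y , Py , maximal) → pure (y , ≼-trans x≼z z≼y , Py , maximal)
      }
      where
      step : ∀ d {z} → bound ≤ d + μ x → μ x < μ z → P z → ¬ ¬ MaximalAbove z
      step zero    bound≤ μx<μz _  = λ _ → <⇒≱ (<-≤-trans μx<μz (μ≤bound _)) bound≤
      step (suc d) {z} bound≤ μx<μz Pz =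
        climb d (≤-trans bound≤ (≡.subst (_≤ d + μ z) (+-suc d (μ x)) (+-monoʳ-≤ d μx<μz))) Pz

module _ {n : ℕ} where

  open DecMembership (_≟_ {n}) using (_∈?_)

  Adj-sym : (G : Graph n) {u v : Fin n} → Adj G u v → Adj G v u
  Adj-sym G {u} {v} = ≡.subst T (adj-sym G u v)

  Adj⇒≢ : (G : Graph n) {u v : Fin n} → Adj G u v → u ≢ v
  Adj⇒≢ G {u} a ≡.refl = ≡.subst T (adj-irr G u) a

  Adj⇒InVˡ : (G : Graph n) {u v : Fin n} → Adj G u v → InV G u
  Adj⇒InVˡ G {u} {v} = adj-V G u v

  Adj⇒InVʳ : (G : Graph n) {u v : Fin n} → Adj G u v → InV G v
  Adj⇒InVʳ G {u} {v} = adj-V G v u ∘ Adj-sym G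

  ⊆G-refl : {H : Graph n} → H ⊆G H
  ⊆G-refl = (λ _ → id) , (λ _ _ → id)

  ⊆G-trans : {H K L : Graph n} → H ⊆G K → K ⊆G L → H ⊆G L
  ⊆G-trans (V⊆ , adj⊆) (V⊆′ , adj⊆′) = (λ v → V⊆′ v ∘ V⊆ v) , (λ u v → adj⊆′ u v ∘ adj⊆ u v)

  ⊆G-stable : {H K : Graph n} → ¬ ¬ H ⊆G K → H ⊆G K
  ⊆G-stable {H} {K} ¬¬H⊆K =
      (λ v Hv → decidable-stable (T? _) ((λ H⊆K → proj₁ H⊆K v Hv) <$> ¬¬H⊆K))
    , (λ u v Huv → decidable-stable (T? _) ((λ H⊆K → proj₂ H⊆K u v Huv) <$> ¬¬H⊆K))

  -- S itself is the vertex set, so this is a subgraph of G only when S ⊆ V G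
  induced : Graph n → (Fin n → Bool) → Graph n
  induced G S = record
    { V       = S
    ; adj     = λ a b → adj G a b ∧ (S a ∧ S b)
    ; adj-sym = λ a b → ≡.cong₂ _∧_ (adj-sym G a b) (∧-comm (S a) (S b))
    ; adj-irr = λ a → ≡.cong (_∧ (S a ∧ S a)) (adj-irr G a)
    ; adj-V   = λ a b Gab∧Sab → proj₁ (Equivalence.to T-∧ (proj₂ (Equivalence.to (T-∧ {adj G a b}) Gab∧Sab)))
    }

  Adj-induced⁺ : (G : Graph n) (S : Fin n → Bool) {a b : Fin n} → Adj G a b → T (S a) → T (S b) →
    Adj (induced G S) a b
  Adj-induced⁺ G S Gab Sa Sb = Equivalence.from T-∧ (Gab , Equivalence.from T-∧ (Sa , Sb))

  Adj-induced⁻ : (G : Graph n) (S : Fin n → Bool) {a b : Fin n} → Adj (induced G S) a b → Adj G a b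
  Adj-induced⁻ G S {a} {b} = proj₁ ∘ Equivalence.to (T-∧ {adj G a b})

  induced-⊆G : (G : Graph n) (S : Fin n → Bool) → (∀ v → T (S v) → InV G v) → induced G S ⊆G G
  induced-⊆G G S S⊆V = S⊆V , λ _ _ → Adj-induced⁻ G S

  ∈ᵇ : List (Fin n) → Fin n → Bool
  ∈ᵇ xs v = ⌊ v ∈? xs ⌋

  ∈ᵇ⁺ : {xs : List (Fin n)} {v : Fin n} → v ∈ xs → T (∈ᵇ xs v)
  ∈ᵇ⁺ {xs} {v} = fromWitness {a? = v ∈? xs}

  ∈ᵇ⁻ : {xs : List (Fin n)} {v : Fin n} → T (∈ᵇ xs v) → v ∈ xs
  ∈ᵇ⁻ {xs} {v} = toWitness {a? = v ∈? xs}

  inducedOn : Graph n → List (Fin n) → Graph n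
  inducedOn G xs = induced G (∈ᵇ xs)

  Adj-inducedOn⁺ : (G : Graph n) {xs : List (Fin n)} {a b : Fin n} → Adj G a b → a ∈ xs → b ∈ xs →
    Adj (inducedOn G xs) a b
  Adj-inducedOn⁺ G {xs} Gab a∈xs b∈xs = Adj-induced⁺ G (∈ᵇ xs) Gab (∈ᵇ⁺ a∈xs) (∈ᵇ⁺ b∈xs)

  vertices : Graph n → List (Fin n)
  vertices H = filter (λ v → T? (V H v)) (allFin n)

  vertices-unique : (H : Graph n) → Unique (vertices H)
  vertices-unique H = Unique.filter⁺ (λ v → T? (V H v)) (Unique.allFin⁺ n)

  ∈-vertices⁺ : (H : Graph n) {v : Fin n} → InV H v → v ∈ vertices H
  ∈-vertices⁺ H {v} = ∈-filter⁺ (λ v → T? (V H v)) (∈-allFin v)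

  ∈-vertices⁻ : (H : Graph n) {v : Fin n} → v ∈ vertices H → InV H v
  ∈-vertices⁻ H = proj₂ ∘ ∈-filter⁻ (λ v → T? (V H v)) {xs = allFin n}

  length≤∣V∣ : (H : Graph n) {xs : List (Fin n)} → Unique xs → All (InV H) xs → length xs ≤ ∣V∣ H
  length≤∣V∣ H xs! xs⊆V = Unique⇒length≤ (≡.setoid _) xs! (All.map (∈-vertices⁺ H) xs⊆V)

  ∣V∣≤length : (H : Graph n) {xs : List (Fin n)} → (∀ v → InV H v → v ∈ xs) → ∣V∣ H ≤ length xs
  ∣V∣≤length H V⊆xs = Unique⇒length≤ (≡.setoid _) (vertices-unique H)
    (All.tabulate λ v∈ → V⊆xs _ (∈-vertices⁻ H v∈))

  ∃-vertex-outside : (H : Graph n) (xs : List (Fin n)) → length xs < ∣V∣ H → ¬ ¬ ∃ λ v → InV H v × v ∉ xs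
  ∃-vertex-outside H xs xs<V = ¬¬-excluded-middle >>= λ
    { (yes outside) → pure outside
    ; (no ¬outside) → λ _ → <⇒≱ xs<V
        (∣V∣≤length H λ v Hv → decidable-stable (v ∈? xs) λ v∉xs → ¬outside (v , Hv , v∉xs))
    }

  ∣V∣-mono : {H K : Graph n} → H ⊆G K → ∣V∣ H ≤ ∣V∣ K
  ∣V∣-mono {H} {K} (V⊆ , _) = length≤∣V∣ K (vertices-unique H)
    (All.tabulate λ v∈ → V⊆ _ (∈-vertices⁻ H v∈))

  AdjAvoiding : Graph n → Fin n → Fin n → Fin n → Set
  AdjAvoiding G x a b = Adj G a b × a ≢ x × b ≢ x

  AdjAvoiding-sym : (G : Graph n) {x a b : Fin n} → AdjAvoiding G x a b → AdjAvoiding G x b a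
  AdjAvoiding-sym G (Gab , a≢x , b≢x) = Adj-sym G Gab , b≢x , a≢x

  AdjExcept : Graph n → Fin n → Fin n → Fin n → Fin n → Set
  AdjExcept G u v a b = Adj G a b × ¬ ((a ≡ u × b ≡ v) ⊎ (a ≡ v × b ≡ u))

  walk-avoiding : {H : Graph n} → TwoConnected H → ∀ x {a b} → InV H a → InV H b → a ≢ x → b ≢ x →
    Star (AdjAvoiding H x) a b
  walk-avoiding {H} (_ , connected , avoiding) x {a} {b} Ha Hb a≢x b≢x with T? (V H x)
  ... | yes Hx = avoiding x Hx a b Ha Hb a≢x b≢x
  ... | no ¬Hx = Star.map (λ Hcd → Hcd , ∉H (Adj⇒InVˡ H Hcd) , ∉H (Adj⇒InVʳ H Hcd)) (connected a b Ha Hb)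
    where
    ∉H : ∀ {c} → InV H c → c ≢ x
    ∉H Hc ≡.refl = ¬Hx Hc

  TwoConnected⇒Edge : (H : Graph n) → TwoConnected H → ¬ ¬ Edge H
  TwoConnected⇒Edge H (3≤V , connected , _) = do
    (a , Ha , _)     ← ∃-vertex-outside H [] (≤-trans (s≤s z≤n) 3≤V)
    (b , Hb , b∉[a]) ← ∃-vertex-outside H (a ∷ []) (≤-trans (s≤s (s≤s z≤n)) 3≤V)
    pure (toEdge H (proj₂ (first-step (λ a≡b → b∉[a] (here (≡.sym a≡b))) (connected a b Ha Hb))))

  TwoConnected⇒¬IsBridge : {H G : Graph n} → H ⊆G G → TwoConnected H → ∀ {u v} → Adj H u v → ¬ IsBridge G u v
  TwoConnected⇒¬IsBridge {H} {G} (_ , adj⊆) tc@(3≤V , _) {u} {v} Huv (_ , no-detour) =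
    ∃-vertex-outside H (u ∷ v ∷ []) 3≤V λ (w , Hw , w∉uv) →
      no-detour (Star.map (except {v} (inj₂ ≡.refl)) (walk-avoiding {H} tc v Hu Hw u≢v (w∉uv ∘ there ∘ here))
             ◅◅ Star.map (except {u} (inj₁ ≡.refl)) (walk-avoiding {H} tc u Hw Hv (w∉uv ∘ here) (u≢v ∘ ≡.sym)))
    where
    Hu : InV H u
    Hu = Adj⇒InVˡ H Huv
    Hv : InV H v
    Hv = Adj⇒InVʳ H Huv
    u≢v : u ≢ v
    u≢v = Adj⇒≢ H Huv
    -- a walk avoiding an endpoint of uv does not use the edge uv
    except : ∀ {x} → x ≡ u ⊎ x ≡ v → ∀ {a b} → AdjAvoiding H x a b → AdjExcept G u v a b
    except x≡u∨v (Hab , a≢x , b≢x) = adj⊆ _ _ Hab , λ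
      { (inj₁ (≡.refl , ≡.refl)) → [ (λ { ≡.refl → a≢x ≡.refl }) , (λ { ≡.refl → b≢x ≡.refl }) ] x≡u∨v
      ; (inj₂ (≡.refl , ≡.refl)) → [ (λ { ≡.refl → b≢x ≡.refl }) , (λ { ≡.refl → a≢x ≡.refl }) ] x≡u∨v
      }

  _∪ᴳ_ : Graph n → Graph n → Graph n
  H ∪ᴳ K = record
    { V       = λ a → V H a ∨ V K a
    ; adj     = λ a b → adj H a b ∨ adj K a b
    ; adj-sym = λ a b → ≡.cong₂ _∨_ (adj-sym H a b) (adj-sym K a b)
    ; adj-irr = λ a → ≡.cong₂ _∨_ (adj-irr H a) (adj-irr K a)
    ; adj-V   = λ a b → Equivalence.from T-∨ ∘ Sum.map (adj-V H a b) (adj-V K a b) ∘ Equivalence.to T-∨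
    }

  module _ {H K : Graph n} where

    ⊆∪ᴳˡ : H ⊆G (H ∪ᴳ K)
    ⊆∪ᴳˡ = (λ _ → Equivalence.from T-∨ ∘ inj₁) , (λ _ _ → Equivalence.from T-∨ ∘ inj₁)

    ⊆∪ᴳʳ : K ⊆G (H ∪ᴳ K)
    ⊆∪ᴳʳ = (λ _ → Equivalence.from T-∨ ∘ inj₂) , (λ _ _ → Equivalence.from T-∨ ∘ inj₂)

    ∪ᴳ-⊆G : {G : Graph n} → H ⊆G G → K ⊆G G → (H ∪ᴳ K) ⊆G G
    ∪ᴳ-⊆G (V⊆ , adj⊆) (V⊆′ , adj⊆′) =
        (λ a → [ V⊆ a , V⊆′ a ] ∘ Equivalence.to T-∨)
      , (λ a b → [ adj⊆ a b , adj⊆′ a b ] ∘ Equivalence.to T-∨)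

    -- the shared edge uv leaves a common vertex after deleting any x
    ∪ᴳ-TwoConnected : TwoConnected H → TwoConnected K → ∀ {u v} → Adj H u v → Adj K u v → TwoConnected (H ∪ᴳ K)
    ∪ᴳ-TwoConnected tcH@(3≤H , connectedH , _) tcK@(_ , connectedK , _) {u} {v} Huv Kuv =
      ≤-trans 3≤H (∣V∣-mono {H} {H ∪ᴳ K} ⊆∪ᴳˡ) , connected , avoiding
      where
      U : Graph n
      U = H ∪ᴳ K
      ∪ˡ : ∀ {a b} → Adj H a b → Adj U a b
      ∪ˡ = proj₂ ⊆∪ᴳˡ _ _
      ∪ʳ : ∀ {a b} → Adj K a b → Adj U a b
      ∪ʳ = proj₂ ⊆∪ᴳʳ _ _
      to-u : ∀ a → InV U a → Star (Adj U) a u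
      to-u a = [ (λ Ha → Star.map ∪ˡ (connectedH a u Ha (Adj⇒InVˡ H Huv)))
               , (λ Ka → Star.map ∪ʳ (connectedK a u Ka (Adj⇒InVˡ K Kuv))) ] ∘ Equivalence.to T-∨
      connected : Connected U
      connected a b Ua Ub = to-u a Ua ◅◅ Star.reverse (Adj-sym U) (to-u b Ub)
      common : ∀ x → ∃ λ s → s ≢ x × InV H s × InV K s
      common x with u ≟ x
      ... | yes ≡.refl = v , Adj⇒≢ H Huv ∘ ≡.sym , Adj⇒InVʳ H Huv , Adj⇒InVʳ K Kuv
      ... | no u≢x     = u , u≢x , Adj⇒InVˡ H Huv , Adj⇒InVˡ K Kuv
      avoiding : ∀ x → InV U x → ∀ a b → InV U a → InV U b → a ≢ x → b ≢ x → Star (AdjAvoiding U x) a b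
      avoiding x _ a b Ua Ub a≢x b≢x with common x
      ... | s , s≢x , Hs , Ks = to-s Ua a≢x ◅◅ Star.reverse (AdjAvoiding-sym U) (to-s Ub b≢x)
        where
        to-s : ∀ {a} → InV U a → a ≢ x → Star (AdjAvoiding U x) a s
        to-s Ua a≢x = [ (λ Ha → Star.map (map₁ ∪ˡ) (walk-avoiding {H} tcH x Ha Hs a≢x s≢x))
                      , (λ Ka → Star.map (map₁ ∪ʳ) (walk-avoiding {K} tcK x Ka Ks a≢x s≢x)) ] (Equivalence.to T-∨ Ua)

-- Cycles

module _ {n : ℕ} where

  Linked⇒InV : (G : Graph n) (xs : List (Fin n)) {y : Fin n} → Linked (Adj G) (xs ∷ʳ y) → All (InV G) xs
  Linked⇒InV G []           _       = []
  Linked⇒InV G (x ∷ [])     (r ∷ _) = Adj⇒InVˡ G r ∷ []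
  Linked⇒InV G (x ∷ x′ ∷ xs) (r ∷ l) = Adj⇒InVˡ G r ∷ Linked⇒InV G (x′ ∷ xs) l

  record IsCycle (G : Graph n) (x₀ : Fin n) (xs : List (Fin n)) : Set where
    field
      distinct : Unique (x₀ ∷ xs)
      length≥2 : 2 ≤ length xs
      linked   : Linked (Adj G) (x₀ ∷ xs ∷ʳ x₀)

  module _ {G : Graph n} {x₀ : Fin n} {xs : List (Fin n)} (cycle : IsCycle G x₀ xs) where

    open IsCycle cycle

    private
      W : List (Fin n)
      W = x₀ ∷ xs
      H : Graph n
      H = inducedOn G W

      onH : ∀ {a b} → Adj G a b × a ∈ W × b ∈ W → Adj H a b
      onH (Gab , a∈W , b∈W) = Adj-inducedOn⁺ G Gab a∈W b∈W

    IsCycle-⊆G : inducedOn G W ⊆G G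
    IsCycle-⊆G = induced-⊆G G (∈ᵇ W) λ v v∈W → All.lookup (Linked⇒InV G W linked) (∈ᵇ⁻ v∈W)

    IsCycle-TwoConnected : TwoConnected (inducedOn G W)
    IsCycle-TwoConnected = ≤-trans (s≤s length≥2) (length≤∣V∣ H distinct (All.tabulate ∈ᵇ⁺)) , connected , avoiding
      where
      connected : Connected H
      connected a b Ha Hb = Linked⇒Star (Adj-sym H)
        (Linked.map onH (Linked-∩ (Linked-++⁻ˡ W linked) (All.tabulate λ a∈W → a∈W))) (∈ᵇ⁻ Ha) (∈ᵇ⁻ Hb)
      avoiding : ∀ x → InV H x → ∀ a b → InV H a → InV H b → a ≢ x → b ≢ x → Star (AdjAvoiding H x) a b
      -- cutting the cycle at x leaves the path bs ++ as through all the other vertices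
      avoiding x Hx a b Ha Hb a≢x b≢x with ∈-∃++ (∈ᵇ⁻ Hx)
      ... | as , bs , W≡as++x∷bs = Linked⇒Star (AdjAvoiding-sym H)
        (Linked.map (λ (Gcd , (c∈W , c≢x) , (d∈W , d≢x)) → onH (Gcd , c∈W , d∈W) , c≢x , d≢x)
          (Linked-∩ (Linked-rotate as bs W≡as++x∷bs linked) (All.tabulate λ c∈ → on-W c∈ , avoids-x c∈)))
        (on-path (∈ᵇ⁻ Ha) a≢x) (on-path (∈ᵇ⁻ Hb) b≢x)
        where
        x∉ : x ∉ as × x ∉ bs
        x∉ = ∉-middle as (≡.subst Unique W≡as++x∷bs distinct)
        on-W : ∀ {c} → c ∈ bs ++ as → c ∈ W
        on-W {c} c∈ = ≡.subst (c ∈_) (≡.sym W≡as++x∷bs)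
          ([ ∈-++⁺ʳ as ∘ there , ∈-++⁺ˡ ] (∈-++⁻ bs c∈))
        avoids-x : ∀ {c} → c ∈ bs ++ as → c ≢ x
        avoids-x c∈ ≡.refl = [ proj₂ x∉ , proj₁ x∉ ] (∈-++⁻ bs c∈)
        on-path : ∀ {c} → c ∈ W → c ≢ x → c ∈ bs ++ as
        on-path {c} c∈ c≢x with ∈-++⁻ as (≡.subst (c ∈_) W≡as++x∷bs c∈)
        ... | inj₁ c∈as          = ∈-++⁺ʳ bs c∈as
        ... | inj₂ (here c≡x)    = ⊥-elim (c≢x c≡x)
        ... | inj₂ (there c∈bs)  = ∈-++⁺ˡ c∈bs

next-inject₁ : ∀ {k} (j : Fin k) → next (inject₁ j) ≡ suc j
next-inject₁ {k} j = toℕ-injective (≡.trans (toℕ-fromℕ< _)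
  (≡.trans (≡.cong (λ i → suc i % suc k) (toℕ-inject₁ j)) (m<n⇒m%n≡m (s≤s (toℕ<n j)))))

next-fromℕ : ∀ k → next (fromℕ k) ≡ zero
next-fromℕ k = toℕ-injective (≡.trans (toℕ-fromℕ< _)
  (≡.trans (≡.cong (λ i → suc i % suc k) (toℕ-fromℕ k)) (n%n≡0 (suc k))))

Linked-tabulate : {A : Set} {R : A → A → Set} {m : ℕ} (f : Fin (suc m) → A) {y : A} →
  (∀ j → R (f (inject₁ j)) (f (suc j))) → R (f (fromℕ m)) y → Linked R (tabulate f ∷ʳ y)
Linked-tabulate {m = zero}  f step last = last ∷ [-]
Linked-tabulate {m = suc m} f step last = step zero ∷ Linked-tabulate (f ∘ suc) (step ∘ suc) last

module _ {n : ℕ} {G : Graph n} where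

  Cycle⇒IsCycle : (C : Cycle G) → IsCycle G (vs C zero) (tabulate (vs C ∘ suc))
  Cycle⇒IsCycle C = record
    { distinct = Unique.tabulate⁺ {f = vs C} (vs-inj C _ _)
    ; length≥2 = ≡.subst (2 ≤_) (≡.sym (length-tabulate (vs C ∘ suc))) (s≤s (s≤s z≤n))
    ; linked   = Linked-tabulate (vs C)
        (λ j → ≡.subst (Adj G (vs C (inject₁ j)) ∘ vs C) (next-inject₁ j) (closed C (inject₁ j)))
        (≡.subst (Adj G (vs C (fromℕ _)) ∘ vs C) (next-fromℕ _) (closed C (fromℕ _)))
    }

  vs∈Cycle : (C : Cycle G) (j : Fin (3 + len C)) → vs C j ∈ vs C zero ∷ tabulate (vs C ∘ suc)
  vs∈Cycle C j = ∈-tabulate⁺ {f = vs C} j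

  detour⇒IsCycle : ∀ {u v} → Adj G u v → Star (AdjExcept G u v) u v → ∃ λ xs → IsCycle G u xs × v ∈ xs
  detour⇒IsCycle {u} {v} Guv detour with path Fin._≟_ detour
  ... | ε , _ = ⊥-elim (Adj⇒≢ G Guv ≡.refl)
  ... | (_ , not-uv) ◅ ε , _ = ⊥-elim (not-uv (inj₁ (≡.refl , ≡.refl)))
  ... | p@(_ ◅ q@(_ ◅ r)) , p! = walkVertices q , cycle , target∈walkVertices q
    where
    cycle : IsCycle G u (walkVertices q)
    cycle = record
      { distinct = p!
      ; length≥2 = s≤s (1≤length-walkVertices r)
      ; linked   = walk-linked proj₁ p (Adj-sym G Guv)
      }

-- Blocks

module _ {n : ℕ} where

  vertexPairs : List (Fin n × Fin n)
  vertexPairs = cartesianProduct (allFin n) (allFin n)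

  size : Graph n → ℕ
  size K = countᵇ (V K) (allFin n) + countᵇ (uncurry (adj K)) vertexPairs

  size≤ : ∀ K → size K ≤ length (allFin n) + length vertexPairs
  size≤ K = +-mono-≤ (length-filter (T? ∘ V K) (allFin n)) (length-filter (T? ∘ uncurry (adj K)) vertexPairs)

  size-strict : {H K : Graph n} → H ⊆G K → ¬ K ⊆G H → ¬ ¬ size H < size K
  size-strict {H} {K} (V⊆ , adj⊆) K⊈H = ¬¬-excluded-middle {A = ∃ λ v → InV K v × ¬ InV H v} >>= λ
    { (yes (v , Kv , ¬Hv)) → pure (+-mono-<-≤
        (countᵇ-mono-< (V⊆ _) (∈-allFin v) Kv ¬Hv) (countᵇ-mono (adj⊆ _ _) vertexPairs))
    ; (no no-new-vertex) →
      ¬¬-excluded-middle {A = ∃ λ ab → Adj K (proj₁ ab) (proj₂ ab) × ¬ Adj H (proj₁ ab) (proj₂ ab)} >>= λ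
      { (yes ((a , b) , Kab , ¬Hab)) → pure (+-mono-≤-<
          (countᵇ-mono (V⊆ _) (allFin n))
          (countᵇ-mono-< (adj⊆ _ _) (∈-cartesianProductWith⁺ _,_ (∈-allFin a) (∈-allFin b)) Kab ¬Hab))
      ; (no no-new-edge) → λ _ → K⊈H
          ( (λ v Kv → decidable-stable (T? _) λ ¬Hv → no-new-vertex (v , Kv , ¬Hv))
          , (λ a b Kab → decidable-stable (T? _) λ ¬Hab → no-new-edge ((a , b) , Kab , ¬Hab)))
      }
    }

  maximalTwoConnected-above : {G H : Graph n} → H ⊆G G → TwoConnected H →
    ¬ ¬ ∃ λ K → MaximalTwoConnected G K × H ⊆G K
  maximalTwoConnected-above {G} {H} H⊆G tcH =
    (λ (K , H⊆K , (K⊆G , tcK) , maximal) →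
       K , (K⊆G , tcK , λ K′ K⊆K′ K′⊆G tcK′ → maximal K′ K⊆K′ (K′⊆G , tcK′)) , H⊆K)
    <$> ¬¬-maximal-above _⊆G_ (λ {K} → ⊆G-refl {H = K}) (λ {K} {L} {M} → ⊆G-trans {H = K} {L} {M})
          (λ {K} {L} → ⊆G-stable {H = K} {L}) size _ size≤ (λ {K} {L} → size-strict {K} {L})
          (λ K → K ⊆G G × TwoConnected K) {H} (H⊆G , tcH)

module _ {n : ℕ} where

  Ends : Fin n → Fin n → Fin n → Fin n → Set
  Ends p q a b = (a ≡ p × b ≡ q) ⊎ (a ≡ q × b ≡ p)

  Ends-sym : ∀ {p q a b} → Ends p q a b → Ends a b p q
  Ends-sym (inj₁ (≡.refl , ≡.refl)) = inj₁ (≡.refl , ≡.refl)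
  Ends-sym (inj₂ (≡.refl , ≡.refl)) = inj₂ (≡.refl , ≡.refl)

  Ends-trans : ∀ {p q a b c d} → Ends p q a b → Ends a b c d → Ends p q c d
  Ends-trans (inj₁ (≡.refl , ≡.refl)) ab=cd = ab=cd
  Ends-trans (inj₂ (≡.refl , ≡.refl)) (inj₁ (≡.refl , ≡.refl)) = inj₂ (≡.refl , ≡.refl)
  Ends-trans (inj₂ (≡.refl , ≡.refl)) (inj₂ (≡.refl , ≡.refl)) = inj₁ (≡.refl , ≡.refl)

  Ends-vertex : ∀ {p q a b w} → Ends p q a b → w ≡ a ⊎ w ≡ b → w ≡ p ⊎ w ≡ q
  Ends-vertex (inj₁ (≡.refl , ≡.refl)) w∈ab = w∈ab
  Ends-vertex (inj₂ (≡.refl , ≡.refl)) (inj₁ w≡a) = inj₂ w≡a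
  Ends-vertex (inj₂ (≡.refl , ≡.refl)) (inj₂ w≡b) = inj₁ w≡b

  Ends-Adj : (H : Graph n) {p q a b : Fin n} → Ends p q a b → Adj H a b → Adj H p q
  Ends-Adj H (inj₁ (≡.refl , ≡.refl)) Hab = Hab
  Ends-Adj H (inj₂ (≡.refl , ≡.refl)) Hab = Adj-sym H Hab

  ∈-pair⇔ : ∀ {u v w : Fin n} → (w ∈ u ∷ v ∷ [] → w ≡ u ⊎ w ≡ v) × (w ≡ u ⊎ w ≡ v → w ∈ u ∷ v ∷ [])
  ∈-pair⇔ = (λ { (here w≡u) → inj₁ w≡u ; (there (here w≡v)) → inj₂ w≡v })
          , [ here , there ∘ here ]

  IsBridge⇒BridgeBlock : {G : Graph n} {u v : Fin n} → IsBridge G u v → BridgeBlock G (inducedOn G (u ∷ v ∷ []))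
  IsBridge⇒BridgeBlock {G} {u} {v} bridge@(Guv , _) = u , v , bridge
    , (λ w → proj₁ ∈-pair⇔ ∘ ∈ᵇ⁻ , ∈ᵇ⁺ ∘ proj₂ ∈-pair⇔)
    , λ a b → ends , λ
      { (inj₁ (≡.refl , ≡.refl)) → Adj-inducedOn⁺ G Guv (here ≡.refl) (there (here ≡.refl))
      ; (inj₂ (≡.refl , ≡.refl)) → Adj-inducedOn⁺ G (Adj-sym G Guv) (there (here ≡.refl)) (here ≡.refl)
      }
    where
    H : Graph n
    H = inducedOn G (u ∷ v ∷ [])
    ends : ∀ {a b} → Adj H a b → Ends u v a b
    ends Hab with proj₁ ∈-pair⇔ (∈ᵇ⁻ (Adj⇒InVˡ H Hab)) | proj₁ ∈-pair⇔ (∈ᵇ⁻ (Adj⇒InVʳ H Hab))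
    ... | inj₁ ≡.refl | inj₂ ≡.refl = inj₁ (≡.refl , ≡.refl)
    ... | inj₂ ≡.refl | inj₁ ≡.refl = inj₂ (≡.refl , ≡.refl)
    ... | inj₁ ≡.refl | inj₁ ≡.refl = ⊥-elim (Adj⇒≢ H Hab ≡.refl)
    ... | inj₂ ≡.refl | inj₂ ≡.refl = ⊥-elim (Adj⇒≢ H Hab ≡.refl)

  module _ {G : Graph n} where

    IsBlock⇒⊆G : {H : Graph n} → IsBlock G H → H ⊆G G
    IsBlock⇒⊆G (inj₁ (H⊆G , _)) = H⊆G
    IsBlock⇒⊆G (inj₂ (u , v , (Guv , _) , vertices , edges)) =
        (λ w → [ (λ { ≡.refl → Adj⇒InVˡ G Guv }) , (λ { ≡.refl → Adj⇒InVʳ G Guv }) ] ∘ proj₁ (vertices w))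
      , (λ a b → [ (λ { (≡.refl , ≡.refl) → Guv }) , (λ { (≡.refl , ≡.refl) → Adj-sym G Guv }) ] ∘ proj₁ (edges a b))

    IsBlock⇒Edge : {H : Graph n} → IsBlock G H → ¬ ¬ Edge H
    IsBlock⇒Edge {H} (inj₁ (_ , tcH , _))           = TwoConnected⇒Edge H tcH
    IsBlock⇒Edge {H} (inj₂ (u , v , _ , _ , edges)) = pure (toEdge H (proj₂ (edges u v) (inj₁ (≡.refl , ≡.refl))))

    TwoConnected⇒⊆block : {H : Graph n} → H ⊆G G → TwoConnected H → ¬ ¬ ∃ λ K → IsBlock G K × H ⊆G K
    TwoConnected⇒⊆block {H} H⊆G tcH =
      (λ (K , maxK , H⊆K) → K , inj₁ maxK , H⊆K) <$> maximalTwoConnected-above {G = G} {H = H} H⊆G tcH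

    edge-in-block : ∀ {u v} → Adj G u v → ¬ ¬ ∃ λ H → IsBlock G H × Adj H u v
    edge-in-block {u} {v} Guv = ¬¬-excluded-middle {A = Star (AdjExcept G u v) u v} >>= λ
      { (no no-detour) → pure ( inducedOn G (u ∷ v ∷ []) , inj₂ (IsBridge⇒BridgeBlock {G} (Guv , no-detour))
                              , Adj-inducedOn⁺ G Guv (here ≡.refl) (there (here ≡.refl)))
      ; (yes detour) → let xs , cycle , v∈xs = detour⇒IsCycle {G = G} Guv detour in
          (λ (H , blockH , (_ , cycle⊆H)) → H , blockH , cycle⊆H u v (Adj-inducedOn⁺ G Guv (here ≡.refl) (there v∈xs)))
          <$> TwoConnected⇒⊆block {H = inducedOn G (u ∷ xs)} (IsCycle-⊆G cycle) (IsCycle-TwoConnected cycle)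
      }

    cycle-in-block : (C : Cycle G) → ¬ ¬ ∃ λ H → IsBlock G H × (∀ j → Adj H (vs C j) (vs C (next j)))
    cycle-in-block C =
      (λ (H , blockH , (_ , C⊆H)) → H , blockH , λ j →
         C⊆H _ _ (Adj-inducedOn⁺ G (closed C j) (vs∈Cycle C j) (vs∈Cycle C (next j))))
      <$> TwoConnected⇒⊆block {H = inducedOn G (vs C zero ∷ tabulate (vs C ∘ suc))}
            (IsCycle-⊆G cycle) (IsCycle-TwoConnected cycle)
      where
      cycle : IsCycle G (vs C zero) (tabulate (vs C ∘ suc))
      cycle = Cycle⇒IsCycle C

    blocks-sharing-edge : {H K : Graph n} → IsBlock G H → IsBlock G K → ∀ {u v} → Adj H u v → Adj K u v →
      SameGraph H K
    blocks-sharing-edge {H} {K} (inj₁ (H⊆G , tcH , maxH)) (inj₁ (K⊆G , tcK , maxK)) Huv Kuv =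
        ⊆G-trans {H = H} {H ∪ᴳ K} {K} (⊆∪ᴳˡ {H = H} {K}) (maxK (H ∪ᴳ K) (⊆∪ᴳʳ {H = H} {K}) H∪K⊆G tcH∪K)
      , ⊆G-trans {H = K} {H ∪ᴳ K} {H} (⊆∪ᴳʳ {H = H} {K}) (maxH (H ∪ᴳ K) (⊆∪ᴳˡ {H = H} {K}) H∪K⊆G tcH∪K)
      where
      H∪K⊆G : (H ∪ᴳ K) ⊆G G
      H∪K⊆G = ∪ᴳ-⊆G {H = H} {K = K} {G} H⊆G K⊆G
      tcH∪K : TwoConnected (H ∪ᴳ K)
      tcH∪K = ∪ᴳ-TwoConnected {H = H} {K = K} tcH tcK Huv Kuv
    blocks-sharing-edge {H} (inj₁ (H⊆G , tcH , _)) (inj₂ (p , q , bridge , _ , edges)) Huv Kuv =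
      ⊥-elim (TwoConnected⇒¬IsBridge {H = H} {G} H⊆G tcH (Ends-Adj H (proj₁ (edges _ _) Kuv) Huv) bridge)
    blocks-sharing-edge {K = K} (inj₂ (p , q , bridge , _ , edges)) (inj₁ (K⊆G , tcK , _)) Huv Kuv =
      ⊥-elim (TwoConnected⇒¬IsBridge {H = K} {G} K⊆G tcK (Ends-Adj K (proj₁ (edges _ _) Huv) Kuv) bridge)
    blocks-sharing-edge (inj₂ (p , q , _ , verticesH , edgesH)) (inj₂ (p′ , q′ , _ , verticesK , edgesK)) Huv Kuv =
      ( (λ w → proj₂ (verticesK w) ∘ Ends-vertex pq=p′q′ ∘ proj₁ (verticesH w))
      , (λ a b → proj₂ (edgesK a b) ∘ Ends-trans pq=p′q′ ∘ proj₁ (edgesH a b)) )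
      , ( (λ w → proj₂ (verticesH w) ∘ Ends-vertex (Ends-sym pq=p′q′) ∘ proj₁ (verticesK w))
        , (λ a b → proj₂ (edgesH a b) ∘ Ends-trans (Ends-sym pq=p′q′) ∘ proj₁ (edgesK a b)) )
      where
      pq=p′q′ : Ends p′ q′ p q
      pq=p′q′ = Ends-trans (proj₁ (edgesK _ _) Kuv) (Ends-sym (proj₁ (edgesH _ _) Huv))

colourCount : ∀ {m} → (Fin m → Colour) → Colour → ℕ
colourCount f col = length (filter (λ i → f i ≟ᶜ col) (allFin _))

MonochromaticOrTwoOfEach : ∀ {m} → (Fin m → Colour) → Set
MonochromaticOrTwoOfEach f = (∀ i j → f i ≡ f j) ⊎ (2 ≤ colourCount f red × 2 ≤ colourCount f blue)

colourCount-cong : ∀ {m} {f g : Fin m → Colour} → (∀ i → f i ≡ g i) → ∀ col → colourCount f col ≡ colourCount g col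
colourCount-cong f≗g col = ≡.cong length (filter-≐ (λ i → _ ≟ᶜ col) (λ i → _ ≟ᶜ col)
  ((λ {i} fi≡col → ≡.trans (≡.sym (f≗g i)) fi≡col) , (λ {i} gi≡col → ≡.trans (f≗g i) gi≡col)) (allFin _))

MonochromaticOrTwoOfEach-cong : ∀ {m} {f g : Fin m → Colour} → (∀ i → f i ≡ g i) →
  MonochromaticOrTwoOfEach f → MonochromaticOrTwoOfEach g
MonochromaticOrTwoOfEach-cong f≗g (inj₁ mono) = inj₁ λ i j → ≡.trans (≡.sym (f≗g i)) (≡.trans (mono i j) (f≗g j))
MonochromaticOrTwoOfEach-cong f≗g (inj₂ (two-red , two-blue)) =
  inj₂ (≡.subst (2 ≤_) (colourCount-cong f≗g red) two-red , ≡.subst (2 ≤_) (colourCount-cong f≗g blue) two-blue)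

≢red⇒≡blue : ∀ {col} → col ≢ red → col ≡ blue
≢red⇒≡blue {red}  col≢red = ⊥-elim (col≢red ≡.refl)
≢red⇒≡blue {blue} _       = ≡.refl

≢blue⇒≡red : ∀ {col} → col ≢ blue → col ≡ red
≢blue⇒≡red {red}  _        = ≡.refl
≢blue⇒≡red {blue} col≢blue = ⊥-elim (col≢blue ≡.refl)

module _ {n : ℕ} where

  colouring-setoid : Graph n → Setoid 0ℓ 0ℓ
  colouring-setoid G = Edge G →-setoid Colour

  CycleCondition : (G : Graph n) → Colouring G → Set
  CycleCondition G c = ∀ (C : Cycle G) → MonochromaticOrTwoOfEach (λ i → c (cedge C i))

  monochromatic : (G : Graph n) → Colour → Colouring G
  monochromatic G col _ = col

  monochromatic-cycleCondition : (G : Graph n) (col : Colour) → CycleCondition G (monochromatic G col)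
  monochromatic-cycleCondition G col C = inj₁ λ _ _ → ≡.refl

  NAC⇒non-monochromatic : (G : Graph n) {c : Colouring G} → IsNAC G c →
    ∀ col → ¬ (_≗ᶜ_ {G = G} c (monochromatic G col))
  NAC⇒non-monochromatic G ((e , ce≡red) , (f , cf≡blue) , _) col c≡col =
    red≢blue (≡.trans (≡.sym ce≡red) (≡.trans (c≡col e) (≡.trans (≡.sym (c≡col f)) cf≡blue)))
    where
    red≢blue : red ≢ blue
    red≢blue ()

  NACCount⇒enumeration : (G : Graph n) {m : ℕ} → NACCount G m →
    ∃ λ xs → length xs ≡ m × Enumeration (colouring-setoid G) (IsNAC G) xs
  NACCount⇒enumeration G (xs , length≡m , nac , unique , complete) =
    xs , length≡m , record { unique = unique ; sound = nac ; complete = λ {c} nac-c → pure (complete c nac-c) }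

  cycleCondition-enumeration : (G : Graph n) → ¬ ¬ Edge G → ∀ {xs} →
    Enumeration (colouring-setoid G) (IsNAC G) xs →
    Enumeration (colouring-setoid G) (CycleCondition G) (xs ++ monochromatic G red ∷ monochromatic G blue ∷ [])
  cycleCondition-enumeration G ¬¬edge {xs} enum = record
    { unique   = AllPairs.++⁺ (unique enum) ((red≢blue ∷ []) ∷ [] ∷ [])
                   (All.map (λ nac → non-mono nac red ∷ non-mono nac blue ∷ []) (sound enum))
    ; sound    = All.++⁺ (All.map (proj₂ ∘ proj₂) (sound enum))
                   (monochromatic-cycleCondition G red ∷ monochromatic-cycleCondition G blue ∷ [])
    ; complete = λ {c} → complete-with-monochromatic c
    }
    where
    S : Setoid 0ℓ 0ℓ
    S = colouring-setoid G
    non-mono : ∀ {c} → IsNAC G c → ∀ col → ¬ (_≗ᶜ_ {G = G} c (monochromatic G col))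
    non-mono = NAC⇒non-monochromatic G
    red≢blue : ¬ (_≗ᶜ_ {G = G} (monochromatic G red) (monochromatic G blue))
    red≢blue red≡blue = ¬¬edge λ e → case red≡blue e of λ ()
    complete-with-monochromatic : ∀ c → CycleCondition G c →
      ¬ ¬ Any (_≗ᶜ_ {G = G} c) (xs ++ monochromatic G red ∷ monochromatic G blue ∷ [])
    complete-with-monochromatic c cc = ¬¬-excluded-middle >>= λ
      { (no no-red)   → pure (SetoidMembershipProperties.∈-++⁺ʳ S xs
                          (there (here λ e → ≢red⇒≡blue λ ce≡red → no-red (e , ce≡red))))
      ; (yes has-red) → ¬¬-excluded-middle >>= λ
        { (no no-blue)   → pure (SetoidMembershipProperties.∈-++⁺ʳ S xs
                             (here λ e → ≢blue⇒≡red λ ce≡blue → no-blue (e , ce≡blue)))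
        ; (yes has-blue) → SetoidMembershipProperties.∈-++⁺ˡ S <$> complete enum (has-red , has-blue , cc)
        }
      }

  NACCount⇒cycleCondition-enumeration : (G : Graph n) → ¬ ¬ Edge G → ∀ {m} → NACCount G m →
    ∃ λ xs → length xs ≡ m + 2 × Enumeration (colouring-setoid G) (CycleCondition G) xs
  NACCount⇒cycleCondition-enumeration G ¬¬edge count with NACCount⇒enumeration G count
  ... | xs , length≡m , enum = _ , ≡.trans (length-++ xs) (≡.cong (_+ 2) length≡m)
                                 , cycleCondition-enumeration G ¬¬edge enum

module _ {n : ℕ} where

  Edge-≡ : {G : Graph n} {u v : Fin n} {p q : u <ᶠ v} {a b : Adj G u v} →
    _≡_ {A = Edge G} (u , v , p , a) (u , v , q , b)
  Edge-≡ {u = u} {v} {p} {q} {a} {b} = ≡.cong₂ (λ p a → u , v , p , a) (<-irrelevant p q) (T-irrelevant a b)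

  mapEdge : {H G : Graph n} → (∀ u v → Adj H u v → Adj G u v) → Edge H → Edge G
  mapEdge H⊆G (u , v , u<v , a) = u , v , u<v , H⊆G u v a

  mapEdge-toEdge : {H G : Graph n} (H⊆G : ∀ u v → Adj H u v → Adj G u v) {u v : Fin n}
    (a : Adj H u v) (b : Adj G u v) → mapEdge {H} {G} H⊆G (toEdge H a) ≡ toEdge G b
  mapEdge-toEdge {H} {G} H⊆G {u} {v} a b with <-cmp u v
  ... | tri< _ _ _    = Edge-≡ {G = G}
  ... | tri≈ _ ≡.refl _ = ⊥-elim (≡.subst T (adj-irr H u) a)
  ... | tri> _ _ _    = Edge-≡ {G = G}

  mapCycle : {H G : Graph n} → (∀ u v → Adj H u v → Adj G u v) → Cycle H → Cycle G
  mapCycle H⊆G C = record { len = len C ; vs = vs C ; vs-inj = vs-inj C ; closed = λ i → H⊆G _ _ (closed C i) }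

  cycleWithin : {G : Graph n} (H : Graph n) (C : Cycle G) → (∀ i → Adj H (vs C i) (vs C (next i))) → Cycle H
  cycleWithin H C closedH = record { len = len C ; vs = vs C ; vs-inj = vs-inj C ; closed = closedH }

  CycleCondition-restrict : {H G : Graph n} (H⊆G : ∀ u v → Adj H u v → Adj G u v) {c : Colouring G} →
    CycleCondition G c → CycleCondition H (c ∘ mapEdge {H} {G} H⊆G)
  CycleCondition-restrict {G = G} H⊆G {c} ccG C = MonochromaticOrTwoOfEach-cong
    (λ i → ≡.cong c (≡.sym (mapEdge-toEdge H⊆G (closed C i) _))) (ccG (mapCycle H⊆G C))

-- Colourings along a decomposition into blocks

record BlockDecomposition {n : ℕ} (G : Graph n) {k : ℕ} (B : Fin k → Graph n) : Set where
  field
    block-adj⊆     : ∀ i u v → Adj (B i) u v → Adj G u v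
    block-of-edge  : ∀ {u v} → Adj G u v → ∃ λ i → Adj (B i) u v
    block-unique   : ∀ {i j u v} → Adj (B i) u v → Adj (B j) u v → i ≡ j
    block-of-cycle : (C : Cycle G) → ∃ λ i → ∀ j → Adj (B i) (vs C j) (vs C (next j))

module _ {n : ℕ} {G : Graph n} {k : ℕ} {B : Fin k → Graph n} (D : BlockDecomposition G B) where

  open BlockDecomposition D

  restrict : Colouring G → ∀ i → Colouring (B i)
  restrict c i = c ∘ mapEdge {H = B i} {G = G} (block-adj⊆ i)

  glue : (∀ i → Colouring (B i)) → Colouring G
  glue t (u , v , u<v , a) = t (proj₁ (block-of-edge a)) (u , v , u<v , proj₂ (block-of-edge a))

  glue-restrict : ∀ c e → glue (restrict c) e ≡ c e
  glue-restrict c (u , v , u<v , a) = ≡.cong c (Edge-≡ {G = G})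

  restrict-glue : ∀ t i e → restrict (glue t) i e ≡ t i e
  restrict-glue t i (u , v , u<v , a) = colour-at (block-unique b a) b a
    where
    b : Adj (B (proj₁ (block-of-edge (block-adj⊆ i u v a)))) u v
    b = proj₂ (block-of-edge (block-adj⊆ i u v a))
    colour-at : ∀ {i j} → i ≡ j → (a : Adj (B i) u v) (b : Adj (B j) u v) →
      t i (u , v , u<v , a) ≡ t j (u , v , u<v , b)
    colour-at {i} ≡.refl a b = ≡.cong (t i) (Edge-≡ {G = B i})

  colouring-inverse : Inverse (colouring-setoid G) (Π-setoid (colouring-setoid ∘ B))
  colouring-inverse = record
    { to        = restrict
    ; from      = glue
    ; to-cong   = to-cong
    ; from-cong = from-cong
    ; inverse   = strictlyInverseˡ⇒inverseˡ Sᴳ Sᴮ to-cong restrict-glue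
                , strictlyInverseʳ⇒inverseʳ Sᴳ Sᴮ from-cong glue-restrict
    }
    where
    Sᴳ Sᴮ : Setoid 0ℓ 0ℓ
    Sᴳ = colouring-setoid G
    Sᴮ = Π-setoid (colouring-setoid ∘ B)
    to-cong : ∀ {c d} → (∀ e → c e ≡ d e) → ∀ i e → restrict c i e ≡ restrict d i e
    to-cong c≗d i e = c≗d (mapEdge {H = B i} {G = G} (block-adj⊆ i) e)
    from-cong : ∀ {s t} → (∀ i e → s i e ≡ t i e) → ∀ e → glue s e ≡ glue t e
    from-cong s≈t (u , v , u<v , a) = s≈t _ _

  glue-cycleCondition : ∀ {t} → (∀ i → CycleCondition (B i) (t i)) → CycleCondition G (glue t)
  glue-cycleCondition {t} cc C with block-of-cycle C
  ... | i , C⊆Bi = MonochromaticOrTwoOfEach-cong same-colours (cc i (cycleWithin (B i) C C⊆Bi))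
    where
    same-colours : ∀ j → t i (toEdge (B i) (C⊆Bi j)) ≡ glue t (cedge C j)
    same-colours j = begin
      t i (toEdge (B i) (C⊆Bi j))
        ≡⟨ restrict-glue t i _ ⟨
      glue t (mapEdge {H = B i} {G = G} (block-adj⊆ i) (toEdge (B i) (C⊆Bi j)))
        ≡⟨ ≡.cong (glue t) (mapEdge-toEdge (block-adj⊆ i) (C⊆Bi j) (closed C j)) ⟩
      glue t (cedge C j)
        ∎
      where open ≡-Reasoning

  cycleCondition-count : ∀ {xs ls} → Enumeration (colouring-setoid G) (CycleCondition G) xs →
    (∀ i → Enumeration (colouring-setoid (B i)) (CycleCondition (B i)) (ls i)) →
    length xs ≡ product (tabulate (length ∘ ls))
  cycleCondition-count {ls = ls} enumG enumB = ≡.trans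
    (enumeration-length-≡ colouring-inverse
      (λ {c} cc i → CycleCondition-restrict {H = B i} {G = G} (block-adj⊆ i) {c} cc)
      (λ {t} → glue-cycleCondition {t})
      enumG (tuples-enumeration (colouring-setoid ∘ B) enumB))
    (length-tuples ls)

module _ {n : ℕ} {G : Graph n} {k : ℕ} {B : Fin k → Graph n}
         (blocks : ∀ i → IsBlock G (B i))
         (distinct : ∀ i j → SameGraph (B i) (B j) → i ≡ j)
         (cover : ∀ H → IsBlock G H → ∃ λ i → SameGraph H (B i)) where

  blockDecomposition : BlockDecomposition G B
  blockDecomposition = record
    { block-adj⊆     = λ i → proj₂ (IsBlock⇒⊆G {G = G} {H = B i} (blocks i))
    ; block-of-edge  = λ {u} {v} Guv → decidable-stable (Fin.any? λ i → T? (adj (B i) u v))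
        ((λ (H , blockH , Huv) → let i , H≅Bi = cover H blockH in i , proj₂ (proj₁ H≅Bi) u v Huv)
         <$> edge-in-block {G = G} Guv)
    ; block-unique   = λ {i} {j} Biuv Bjuv →
        distinct i j (blocks-sharing-edge {G = G} {H = B i} {K = B j} (blocks i) (blocks j) Biuv Bjuv)
    ; block-of-cycle = λ C → decidable-stable (Fin.any? λ i → Fin.all? λ j → T? (adj (B i) (vs C j) (vs C (next j))))
        ((λ (H , blockH , C⊆H) → let i , H≅Bi = cover H blockH in i , λ j → proj₂ (proj₁ H≅Bi) _ _ (C⊆H j))
         <$> cycle-in-block C)
    }

lemma5p8 : ∀ {n} (G : Graph n) → Edge G →
    (k : ℕ) (B : Fin k → Graph n) →
    (∀ i → IsBlock G (B i)) →
    (∀ i j → SameGraph (B i) (B j) → i ≡ j) →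
    (∀ H → IsBlock G H → ∃ λ i → SameGraph H (B i)) →
    (N : Fin k → ℕ) → (∀ i → NACCount (B i) (N i)) →
    (m : ℕ) → NACCount G m →
    m + 2 ≡ product (map (λ i → N i + 2) (allFin k))
lemma5p8 G e k B blocks distinct cover N countB m countG
  with NACCount⇒cycleCondition-enumeration G (pure e) countG
... | xs , length-xs , enumG = begin
  m + 2                                        ≡⟨ length-xs ⟨
  length xs                                    ≡⟨ cycleCondition-count (blockDecomposition blocks distinct cover)
                                                    enumG (proj₂ ∘ proj₂ ∘ enumB) ⟩
  product (tabulate (length ∘ proj₁ ∘ enumB))  ≡⟨ ≡.cong product (tabulate-cong (proj₁ ∘ proj₂ ∘ enumB)) ⟩
  product (tabulate (λ i → N i + 2))           ≡⟨ ≡.cong product (map-tabulate id (λ i → N i + 2)) ⟨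
  product (map (λ i → N i + 2) (allFin k))     ∎
  where
  open ≡-Reasoning
  enumB : ∀ i → ∃ λ ys → length ys ≡ N i + 2 × Enumeration (colouring-setoid (B i)) (CycleCondition (B i)) ys
  enumB i = NACCount⇒cycleCondition-enumeration (B i) (IsBlock⇒Edge {G = G} {H = B i} (blocks i)) (countB i)
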